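{- Let $D, t, u, v$ be positive integers such that the continued fraction expansion of $\sqrt{D}$ is $\sqrt{D} = [t; \overline{u, v, u, 2t}]$. Then $$D = t^2 + \frac{2vut + 2t + v}{u(uv + 2)},$$ and there exists $y \in \mathbb{N}$ such that $$D = \left( \frac{u\big(y(uv+2) - v^2\big) - v}{2} \right)^2 + y(uv+2) - v^2 - y.$$
   Context: $[a_0; \overline{a_1, \ldots, a_k}]$ denotes the simple continued fraction with integer part $a_0$ whose positive integer partial quotients $a_1,\dots,a_k$ repeat periodically. -}

module Defs where

open import Data.Nat as ℕ using (ℕ; zero; suc)
open import Data.Integer as ℤ using (ℤ; +_)
open import Data.Rational as ℚ using (ℚ; _≤_; _<_; _+_; _*_; _-_; 0ℚ; 1ℚ)
open import Data.Product using (_×_; _,_; ∃; Σ)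
open import Data.Sum using (_⊎_)
open import Relation.Nullary using (¬_)
open import Relation.Binary.PropositionalEquality using (_≡_)

-- Elements of ℚ(√D) written as a + b√D, represented by the pair (a , b).
-- (Componentwise representation is faithful because we only use it for
-- non-square D, where √D is irrational.)
QD : Set
QD = ℚ × ℚ

ℕ→ℚ : ℕ → ℚ
ℕ→ℚ n = (+ n) ℚ./ 1

ℤ→ℚ : ℤ → ℚ
ℤ→ℚ z = z ℚ./ 1

-- c ≤ b·√D, where √D denotes the non-negative square root of D.
LeSqrt : ℕ → ℚ → ℚ → Set
LeSqrt D c b =
  (0ℚ ≤ b × (c ≤ 0ℚ ⊎ c * c ≤ b * b * ℕ→ℚ D))
  ⊎ (b < 0ℚ × c ≤ 0ℚ × b * b * ℕ→ℚ D ≤ c * c)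

LeQD : ℕ → ℤ → QD → Set
LeQD D n (a , b) = LeSqrt D (ℤ→ℚ n - a) b

IsFloor : ℕ → QD → ℤ → Set
IsFloor D x n = LeQD D n x × ¬ LeQD D (n ℤ.+ ℤ.1ℤ) x

mulQD : ℕ → QD → QD → QD
mulQD D (a , b) (c , d) = (a * c + b * d * ℕ→ℚ D , a * d + b * c)

subℤQD : QD → ℤ → QD
subℤQD (a , b) n = (a - ℤ→ℚ n , b)

oneQD : QD
oneQD = (1ℚ , 0ℚ)

sqrtQD : QD
sqrtQD = (0ℚ , 1ℚ)

IsSquare : ℕ → Set
IsSquare D = ∃ λ k → k ℕ.* k ≡ D

-- "The simple continued fraction expansion of √D has partial quotients a":
-- √D is irrational (D not a perfect square), and there are complete quotients
-- α₀ = √D, αₖ₊₁ = 1 / (αₖ - aₖ), with aₖ = ⌊αₖ⌋ for all k.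
CFExpansionSqrt : ℕ → (ℕ → ℤ) → Set
CFExpansionSqrt D a =
  ¬ IsSquare D ×
  Σ (ℕ → QD) λ α →
    (α 0 ≡ sqrtQD) ×
    (∀ k → IsFloor D (α k) (a k)) ×
    (∀ k → mulQD D (subℤQD (α k) (a k)) (α (suc k)) ≡ oneQD)

periodBlock : ℕ → ℕ → ℕ → ℕ → ℕ
periodBlock t u v 0 = u
periodBlock t u v 1 = v
periodBlock t u v 2 = u
periodBlock t u v 3 = 2 ℕ.* t
periodBlock t u v (suc (suc (suc (suc k)))) = periodBlock t u v k

pattern4 : ℕ → ℕ → ℕ → ℕ → ℤ
pattern4 t u v zero = + t
pattern4 t u v (suc k) = + periodBlock t u v k

-- p / q in ℚ for natural q > 0 (junk value 0 when q = 0, never used here)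
fracℤ : ℤ → ℕ → ℚ
fracℤ p zero = 0ℚ
fracℤ p (suc q) = p ℚ./ suc q

{-# OPTIONS --safe #-}
module Submission where

-- Write the complete quotients of √D as αₖ = (Pₖ + √D)/Qₖ, with Pₖ₊₁ = aₖQₖ − Pₖ and
-- QₖQₖ₊₁ = D − Pₖ₊₁². For T = ⌊√D⌋ one has Qₖ > 0 and Pₖ ≤ T for all k, and a partial
-- quotient 2T at index k forces Qₖ = 1 and Pₖ = T. Here a₄ = 2t, so Q₄ = 1, P₄ = t and
-- Q₃ = D − t² =: C. Unrolling the recurrence from (P₁, Q₁) = (t, C) with partial quotients
-- u, v, u turns P₄ = t into C·u(uv + 2) = 2vut + 2t + v, the first formula. For the second,
-- y = C(uv + 1) − 2tv satisfies (uv + 1)y = C + v², so y ≥ 0, and modulo the first formula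
-- u(y(uv + 2) − v²) − v = 2t and y(uv + 2) − v² − y = C.

open import Defs
open import Data.Nat as ℕ using (ℕ; zero; suc)
import Data.Nat.Properties as ℕP
open import Data.Nat.Coprimality using (1-coprimeTo)
import Data.Nat.Coprimality as Coprime
open import Data.Integer as ℤ using (ℤ; +_; -[1+_]; 0ℤ; 1ℤ; _+_; _*_; _-_; -_; _≤_; _<_)
import Data.Integer.Properties as ℤP
open import Data.Integer.Tactic.RingSolver using (solve; solve-∀)
open import Data.Rational as ℚ using (ℚ; mkℚ; 0ℚ; 1ℚ)
import Data.Rational.Properties as ℚP
import Data.Rational.Unnormalised as ℚᵘ
open import Data.List using (_∷_; [])
open import Data.Product using (_×_; _,_; proj₁; proj₂; ∃)
open import Data.Sum using (_⊎_; inj₁; inj₂)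
open import Function using (_⇔_; mk⇔; Equivalence)
open import Level using (0ℓ)
open import Relation.Nullary using (¬_; contradiction)
open import Relation.Nullary.Decidable using (dec⇒maybe)
open import Relation.Binary.PropositionalEquality
open import Tactic.RingSolver.Core.AlmostCommutativeRing using (AlmostCommutativeRing; fromCommutativeRing)
import Tactic.RingSolver as RingSolver

ℚ-ring : AlmostCommutativeRing 0ℓ 0ℓ
ℚ-ring = fromCommutativeRing ℚP.+-*-commutativeRing (λ x → dec⇒maybe (0ℚ ℚP.≟ x))

-- z /1 is the normal form of ℤ→ℚ z, on which ℚ-arithmetic computes.
_/1 : ℤ → ℚ
z /1 = mkℚ z 0 (Coprime.sym (1-coprimeTo ℤ.∣ z ∣))

ℤ→ℚ≡/1 : ∀ z → ℤ→ℚ z ≡ z /1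
ℤ→ℚ≡/1 (+ n)    = ℚP.normalize-coprime {n} {0} _
ℤ→ℚ≡/1 -[1+ n ] = cong ℚ.-_ (ℚP.normalize-coprime {suc n} {0} _)

ℤ→ℚ-homo-+ : ∀ a b → ℤ→ℚ (a + b) ≡ ℤ→ℚ a ℚ.+ ℤ→ℚ b
ℤ→ℚ-homo-+ a b = begin
  ℤ→ℚ (a + b)             ≡⟨ cong₂ (λ x y → ℤ→ℚ (x + y)) (ℤP.*-identityʳ a) (ℤP.*-identityʳ b) ⟨
  ℤ→ℚ (a * 1ℤ + b * 1ℤ)   ≡⟨⟩
  a /1 ℚ.+ b /1           ≡⟨ cong₂ ℚ._+_ (ℤ→ℚ≡/1 a) (ℤ→ℚ≡/1 b) ⟨
  ℤ→ℚ a ℚ.+ ℤ→ℚ b         ∎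
  where open ≡-Reasoning

ℤ→ℚ-homo-* : ∀ a b → ℤ→ℚ (a * b) ≡ ℤ→ℚ a ℚ.* ℤ→ℚ b
ℤ→ℚ-homo-* a b = sym (cong₂ ℚ._*_ (ℤ→ℚ≡/1 a) (ℤ→ℚ≡/1 b))

ℤ→ℚ-homo‿- : ∀ a → ℤ→ℚ (- a) ≡ ℚ.- ℤ→ℚ a
ℤ→ℚ-homo‿- a = trans (ℤ→ℚ≡/1 (- a)) (sym (trans (cong ℚ.-_ (ℤ→ℚ≡/1 a)) (neg-/1 a)))
  where
  neg-/1 : ∀ a → ℚ.- (a /1) ≡ (- a) /1
  neg-/1 (+ zero)  = refl
  neg-/1 (+ suc n) = refl
  neg-/1 -[1+ n ]  = refl

ℤ→ℚ-homo-sub : ∀ a b → ℤ→ℚ (a - b) ≡ ℤ→ℚ a ℚ.- ℤ→ℚ b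
ℤ→ℚ-homo-sub a b = trans (ℤ→ℚ-homo-+ a (- b)) (cong (ℤ→ℚ a ℚ.+_) (ℤ→ℚ-homo‿- b))

ℤ→ℚ-mono-≤ : ∀ {a b} → a ≤ b → ℤ→ℚ a ℚ.≤ ℤ→ℚ b
ℤ→ℚ-mono-≤ {a} {b} a≤b rewrite ℤ→ℚ≡/1 a | ℤ→ℚ≡/1 b =
  ℚ.*≤* (subst₂ _≤_ (sym (ℤP.*-identityʳ a)) (sym (ℤP.*-identityʳ b)) a≤b)

ℤ→ℚ-cancel-≤ : ∀ {a b} → ℤ→ℚ a ℚ.≤ ℤ→ℚ b → a ≤ b
ℤ→ℚ-cancel-≤ {a} {b} le rewrite ℤ→ℚ≡/1 a | ℤ→ℚ≡/1 b with le
... | ℚ.*≤* a*1≤b*1 = subst₂ _≤_ (ℤP.*-identityʳ a) (ℤP.*-identityʳ b) a*1≤b*1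

ℤ→ℚ-pos : ∀ {a} → 0ℤ < a → ℚ.Positive (ℤ→ℚ a)
ℤ→ℚ-pos {a} 0<a rewrite ℤ→ℚ≡/1 a = ℤ.positive 0<a

fracℤ-* : ∀ c {m} → 0 ℕ.< m → fracℤ (c * + m) m ≡ ℤ→ℚ c
fracℤ-* c {suc n} _ =
  ℚP.fromℚᵘ-cong {ℚᵘ.mkℚᵘ (c * + suc n) n} {ℚᵘ.mkℚᵘ c 0} (ℚᵘ.*≡* (ℤP.*-identityʳ (c * + suc n)))

*-cancelˡ-≡ : ∀ r {x y} .{{_ : ℚ.NonZero r}} → r ℚ.* x ≡ r ℚ.* y → x ≡ y
*-cancelˡ-≡ r {x} {y} rx≡ry = begin
  x                      ≡⟨ undo x ⟨
  ℚ.1/ r ℚ.* (r ℚ.* x)   ≡⟨ cong (ℚ.1/ r ℚ.*_) rx≡ry ⟩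
  ℚ.1/ r ℚ.* (r ℚ.* y)   ≡⟨ undo y ⟩
  y                      ∎
  where
  open ≡-Reasoning
  undo : ∀ z → ℚ.1/ r ℚ.* (r ℚ.* z) ≡ z
  undo z = begin
    ℚ.1/ r ℚ.* (r ℚ.* z)   ≡⟨ ℚP.*-assoc (ℚ.1/ r) r z ⟨
    ℚ.1/ r ℚ.* r ℚ.* z     ≡⟨ cong (ℚ._* z) (ℚP.*-inverseˡ r) ⟩
    1ℚ ℚ.* z               ≡⟨ ℚP.*-identityˡ z ⟩
    z                      ∎

scaled-≤⇔ : ∀ r .{{_ : ℚ.Positive r}} {x y a b} →
  x ℚ.* r ≡ ℤ→ℚ a → y ℚ.* r ≡ ℤ→ℚ b → (x ℚ.≤ y) ⇔ (a ≤ b)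
scaled-≤⇔ r xr≡a yr≡b = mk⇔
  (λ x≤y → ℤ→ℚ-cancel-≤ (subst₂ ℚ._≤_ xr≡a yr≡b (ℚP.*-monoʳ-≤-nonNeg r {{ℚP.pos⇒nonNeg r}} x≤y)))
  (λ a≤b → ℚP.*-cancelʳ-≤-pos r (subst₂ ℚ._≤_ (sym xr≡a) (sym yr≡b) (ℤ→ℚ-mono-≤ a≤b)))

reciprocal-step : ∀ {D p q A Q P′ Q′ c d : ℚ} .{{_ : ℚ.NonZero Q}} →
  q ℚ.* Q ≡ 1ℚ → P′ ≡ A ℚ.* Q ℚ.- p ℚ.* Q → Q ℚ.* Q′ ≡ D ℚ.- P′ ℚ.* P′ →
  (p ℚ.- A) ℚ.* c ℚ.+ q ℚ.* d ℚ.* D ≡ 1ℚ → (p ℚ.- A) ℚ.* d ℚ.+ q ℚ.* c ≡ 0ℚ →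
  c ℚ.* Q′ ≡ P′ × d ℚ.* Q′ ≡ 1ℚ
reciprocal-step {D} {p} {q} {A} {Q} {P′} {Q′} {c} {d} qQ≡1 P′≡ QQ′≡ re≡1 im≡0 = cQ′≡P′ , dQ′≡1
  where
  open ≡-Reasoning
  c≡P′d : c ≡ P′ ℚ.* d
  c≡P′d = sym (begin
    P′ ℚ.* d
      ≡⟨ cong (ℚ._* d) P′≡ ⟩
    (A ℚ.* Q ℚ.- p ℚ.* Q) ℚ.* d
      ≡⟨ RingSolver.solve (A ∷ Q ∷ p ∷ d ∷ c ∷ q ∷ []) ℚ-ring ⟩
    c ℚ.* (q ℚ.* Q) ℚ.- Q ℚ.* ((p ℚ.- A) ℚ.* d ℚ.+ q ℚ.* c)
      ≡⟨ cong₂ (λ x y → c ℚ.* x ℚ.- Q ℚ.* y) qQ≡1 im≡0 ⟩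
    c ℚ.* 1ℚ ℚ.- Q ℚ.* 0ℚ
      ≡⟨ RingSolver.solve (c ∷ Q ∷ []) ℚ-ring ⟩
    c ∎)
  dQ′≡1 : d ℚ.* Q′ ≡ 1ℚ
  dQ′≡1 = *-cancelˡ-≡ Q (begin
    Q ℚ.* (d ℚ.* Q′)
      ≡⟨ RingSolver.solve (Q ∷ d ∷ Q′ ∷ []) ℚ-ring ⟩
    d ℚ.* (Q ℚ.* Q′)
      ≡⟨ cong (d ℚ.*_) QQ′≡ ⟩
    d ℚ.* (D ℚ.- P′ ℚ.* P′)
      ≡⟨ RingSolver.solve (d ∷ D ∷ P′ ∷ []) ℚ-ring ⟩
    1ℚ ℚ.* (d ℚ.* D) ℚ.- P′ ℚ.* (P′ ℚ.* d)
      ≡⟨ cong₂ (λ x y → x ℚ.* (d ℚ.* D) ℚ.- P′ ℚ.* y) qQ≡1 c≡P′d ⟨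
    q ℚ.* Q ℚ.* (d ℚ.* D) ℚ.- P′ ℚ.* c
      ≡⟨ cong (λ x → q ℚ.* Q ℚ.* (d ℚ.* D) ℚ.- x ℚ.* c) P′≡ ⟩
    q ℚ.* Q ℚ.* (d ℚ.* D) ℚ.- (A ℚ.* Q ℚ.- p ℚ.* Q) ℚ.* c
      ≡⟨ RingSolver.solve (q ∷ Q ∷ d ∷ D ∷ A ∷ p ∷ c ∷ []) ℚ-ring ⟩
    Q ℚ.* ((p ℚ.- A) ℚ.* c ℚ.+ q ℚ.* d ℚ.* D)
      ≡⟨ cong (Q ℚ.*_) re≡1 ⟩
    Q ℚ.* 1ℚ ∎)
  cQ′≡P′ : c ℚ.* Q′ ≡ P′
  cQ′≡P′ = begin
    c ℚ.* Q′           ≡⟨ cong (ℚ._* Q′) c≡P′d ⟩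
    P′ ℚ.* d ℚ.* Q′    ≡⟨ ℚP.*-assoc P′ d Q′ ⟩
    P′ ℚ.* (d ℚ.* Q′)  ≡⟨ cong (P′ ℚ.*_) dQ′≡1 ⟩
    P′ ℚ.* 1ℚ          ≡⟨ ℚP.*-identityʳ P′ ⟩
    P′                 ∎

0<1 : 0ℤ < 1ℤ
0<1 = ℤ.+<+ (ℕ.s≤s ℕ.z≤n)

0≤+ : ∀ n → 0ℤ ≤ + n
0≤+ n = ℤ.+≤+ ℕ.z≤n

i<j⇒0<j-i : ∀ {i j} → i < j → 0ℤ < j - i
i<j⇒0<j-i {i} {j} i<j = subst (_< j - i) (ℤP.+-inverseʳ i) (ℤP.+-monoˡ-< (- i) i<j)

*-nonNeg : ∀ {i j} → 0ℤ ≤ i → 0ℤ ≤ j → 0ℤ ≤ i * j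
*-nonNeg {i} {j} 0≤i 0≤j =
  subst (_≤ i * j) (ℤP.*-zeroʳ i) (ℤP.*-monoˡ-≤-nonNeg i {{ℤ.nonNegative 0≤i}} 0≤j)

nonNeg-factor : ∀ {k i} → 0ℤ < k → 0ℤ ≤ k * i → 0ℤ ≤ i
nonNeg-factor {k} {i} 0<k 0≤ki =
  ℤP.*-cancelˡ-≤-pos 0ℤ i k {{ℤ.positive 0<k}} (subst (_≤ k * i) (sym (ℤP.*-zeroʳ k)) 0≤ki)

square-mono : ∀ {i j} → 0ℤ ≤ i → i ≤ j → i * i ≤ j * j
square-mono {i} {j} 0≤i i≤j = ℤP.≤-trans
  (ℤP.*-monoʳ-≤-nonNeg i {{ℤ.nonNegative 0≤i}} i≤j)
  (ℤP.*-monoˡ-≤-nonNeg j {{ℤ.nonNegative (ℤP.≤-trans 0≤i i≤j)}} i≤j)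

≡-mod : ∀ {x y a b} k → a ≡ b → x ≡ y + k * (a - b) → x ≡ y
≡-mod {x} {y} {a} {b} k a≡b x≡ = begin
  x                  ≡⟨ x≡ ⟩
  y + k * (a - b)    ≡⟨ cong (λ z → y + k * (z - b)) a≡b ⟩
  y + k * (b - b)    ≡⟨ solve (y ∷ k ∷ b ∷ []) ⟩
  y                  ∎
  where open ≡-Reasoning

-- m ≤√ D encodes m ≤ √D without square roots.
infix 4 _≤√_
_≤√_ : ℤ → ℕ → Set
m ≤√ D = m ≤ 0ℤ ⊎ m * m ≤ + D

≤√⇒≤ : ∀ {m D T} → 0ℤ ≤ T → + D < (T + 1ℤ) * (T + 1ℤ) → m ≤√ D → m ≤ T
≤√⇒≤ 0≤T _ (inj₁ m≤0) = ℤP.≤-trans m≤0 0≤T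
≤√⇒≤ {m} {D} {T} 0≤T D<[T+1]² (inj₂ m²≤D) = ℤP.≮⇒≥ λ T<m → ℤP.<-irrefl refl (begin-strict
  + D                     <⟨ D<[T+1]² ⟩
  (T + 1ℤ) * (T + 1ℤ)     ≤⟨ square-mono (ℤP.+-mono-≤ 0≤T (ℤP.<⇒≤ 0<1)) (T+1≤m T<m) ⟩
  m * m                   ≤⟨ m²≤D ⟩
  + D                     ∎)
  where
  open ℤP.≤-Reasoning
  T+1≤m : T < m → T + 1ℤ ≤ m
  T+1≤m T<m = subst (_≤ m) (ℤP.+-comm 1ℤ T) (ℤP.i<j⇒suc[i]≤j T<m)

≤√⇒² : ∀ {m D} → 0ℤ < m → m ≤√ D → m * m ≤ + D
≤√⇒² 0<m (inj₁ m≤0)  = contradiction 0<m (ℤP.≤⇒≯ m≤0)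
≤√⇒² 0<m (inj₂ m²≤D) = m²≤D

record State : Set where
  constructor ⟨_,_,_⟩
  field
    P Q Q₋₁ : ℤ
open State

-- α = (P + √D)/Q gives 1/(α − a) = (P′ + √D)/Q′ with P′ = aQ − P and Q′ = (D − P′²)/Q = Q₋₁ + a(P − P′).
next : ℤ → State → State
next a ⟨ P , Q , Q₋₁ ⟩ = ⟨ a * Q - P , Q₋₁ + a * (P - (a * Q - P)) , Q ⟩

-- Starting from α₀ = √D = (0 + √D)/1 with Q₋₁ = D makes Q₋₁Q = D − P² hold from k = 0 on.
states : ℕ → (ℕ → ℤ) → ℕ → State
states D a zero    = ⟨ 0ℤ , 1ℤ , + D ⟩
states D a (suc k) = next (a k) (states D a k)

next-invariant : ∀ {D} a s → Q₋₁ s * Q s ≡ D - P s * P s →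
  Q₋₁ (next a s) * Q (next a s) ≡ D - P (next a s) * P (next a s)
next-invariant {D} a ⟨ P , Q , Q₋₁ ⟩ Q₋₁Q≡ = begin
  Q * (Q₋₁ + a * (P - (a * Q - P)))             ≡⟨ solve (a ∷ P ∷ Q ∷ Q₋₁ ∷ []) ⟩
  Q₋₁ * Q + P * P - (a * Q - P) * (a * Q - P)   ≡⟨ cong (λ x → x + P * P - (a * Q - P) * (a * Q - P)) Q₋₁Q≡ ⟩
  D - P * P + P * P - (a * Q - P) * (a * Q - P) ≡⟨ solve (D ∷ a ∷ P ∷ Q ∷ []) ⟩
  D - (a * Q - P) * (a * Q - P)                 ∎
  where open ≡-Reasoning

states-invariant : ∀ D a k → Q₋₁ (states D a k) * Q (states D a k) ≡ + D - P (states D a k) * P (states D a k)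
states-invariant D a zero    = trans (ℤP.*-identityʳ (+ D)) (sym (ℤP.+-identityʳ (+ D)))
states-invariant D a (suc k) = next-invariant {+ D} (a k) (states D a k) (states-invariant D a k)

states-one : ∀ D a → states D a 1 ≡ ⟨ a 0 , + D - a 0 * a 0 , 1ℤ ⟩
states-one D a = cong₂ (λ p q → ⟨ p , q , 1ℤ ⟩) (P₁≡ (a 0)) (Q₁≡ (+ D) (a 0))
  where
  P₁≡ : ∀ T → T * 1ℤ - 0ℤ ≡ T
  P₁≡ = solve-∀
  Q₁≡ : ∀ D T → D + T * (0ℤ - (T * 1ℤ - 0ℤ)) ≡ D - T * T
  Q₁≡ = solve-∀

-- x ≐ P +√D/ Q says that the element x = p + q√D of ℚ(√D) equals (P + √D)/Q.
infix 4 _≐_+√D/_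
_≐_+√D/_ : QD → ℤ → ℤ → Set
(p , q) ≐ P +√D/ Q = p ℚ.* ℤ→ℚ Q ≡ ℤ→ℚ P × q ℚ.* ℤ→ℚ Q ≡ 1ℚ

LeSqrt⇔≤√ : ∀ {D c q Q m} → 0ℤ < Q →
  c ℚ.* ℤ→ℚ Q ≡ ℤ→ℚ m → q ℚ.* ℤ→ℚ Q ≡ 1ℚ → LeSqrt D c q ⇔ m ≤√ D
LeSqrt⇔≤√ {D} {c} {q} {Q} {m} 0<Q cQ≡m qQ≡1 = mk⇔ to from
  where
  instance
    Q⁺ : ℚ.Positive (ℤ→ℚ Q)
    Q⁺ = ℤ→ℚ-pos 0<Q
    Q²⁺ : ℚ.Positive (ℤ→ℚ Q ℚ.* ℤ→ℚ Q)
    Q²⁺ = ℚP.pos*pos⇒pos (ℤ→ℚ Q) (ℤ→ℚ Q)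
  0<q : 0ℚ ℚ.< q
  0<q = ℚP.*-cancelʳ-<-nonNeg (ℤ→ℚ Q) {{ℚP.pos⇒nonNeg (ℤ→ℚ Q)}}
          (subst₂ ℚ._<_ (sym (ℚP.*-zeroˡ (ℤ→ℚ Q))) (sym qQ≡1) (ℚP.positive⁻¹ 1ℚ))
  c≤0⇔m≤0 : (c ℚ.≤ 0ℚ) ⇔ (m ≤ 0ℤ)
  c≤0⇔m≤0 = scaled-≤⇔ (ℤ→ℚ Q) cQ≡m (ℚP.*-zeroˡ (ℤ→ℚ Q))
  c²≤q²D⇔m²≤D : (c ℚ.* c ℚ.≤ q ℚ.* q ℚ.* ℕ→ℚ D) ⇔ (m * m ≤ + D)
  c²≤q²D⇔m²≤D = scaled-≤⇔ (ℤ→ℚ Q ℚ.* ℤ→ℚ Q) c²Q²≡m² q²DQ²≡D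
    where
    open ≡-Reasoning
    regroup : ∀ x y → x ℚ.* x ℚ.* (y ℚ.* y) ≡ (x ℚ.* y) ℚ.* (x ℚ.* y)
    regroup = RingSolver.solve-∀ ℚ-ring
    regroupᴰ : ∀ x z y → x ℚ.* x ℚ.* z ℚ.* (y ℚ.* y) ≡ (x ℚ.* y) ℚ.* (x ℚ.* y) ℚ.* z
    regroupᴰ = RingSolver.solve-∀ ℚ-ring
    c²Q²≡m² : c ℚ.* c ℚ.* (ℤ→ℚ Q ℚ.* ℤ→ℚ Q) ≡ ℤ→ℚ (m * m)
    c²Q²≡m² = begin
      c ℚ.* c ℚ.* (ℤ→ℚ Q ℚ.* ℤ→ℚ Q)     ≡⟨ regroup c (ℤ→ℚ Q) ⟩
      (c ℚ.* ℤ→ℚ Q) ℚ.* (c ℚ.* ℤ→ℚ Q)   ≡⟨ cong₂ ℚ._*_ cQ≡m cQ≡m ⟩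
      ℤ→ℚ m ℚ.* ℤ→ℚ m                   ≡⟨ ℤ→ℚ-homo-* m m ⟨
      ℤ→ℚ (m * m)                       ∎
    q²DQ²≡D : q ℚ.* q ℚ.* ℕ→ℚ D ℚ.* (ℤ→ℚ Q ℚ.* ℤ→ℚ Q) ≡ ℕ→ℚ D
    q²DQ²≡D = begin
      q ℚ.* q ℚ.* ℕ→ℚ D ℚ.* (ℤ→ℚ Q ℚ.* ℤ→ℚ Q)     ≡⟨ regroupᴰ q (ℕ→ℚ D) (ℤ→ℚ Q) ⟩
      (q ℚ.* ℤ→ℚ Q) ℚ.* (q ℚ.* ℤ→ℚ Q) ℚ.* ℕ→ℚ D   ≡⟨ cong (λ x → x ℚ.* x ℚ.* ℕ→ℚ D) qQ≡1 ⟩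
      1ℚ ℚ.* 1ℚ ℚ.* ℕ→ℚ D                         ≡⟨ ℚP.*-identityˡ (ℕ→ℚ D) ⟩
      ℕ→ℚ D                                       ∎
  to : LeSqrt D c q → m ≤√ D
  to (inj₁ (_ , inj₁ c≤0))   = inj₁ (Equivalence.to c≤0⇔m≤0 c≤0)
  to (inj₁ (_ , inj₂ c²≤q²D)) = inj₂ (Equivalence.to c²≤q²D⇔m²≤D c²≤q²D)
  to (inj₂ (q<0 , _))        = contradiction (ℚP.<-trans 0<q q<0) (ℚP.<-irrefl refl)
  from : m ≤√ D → LeSqrt D c q
  from (inj₁ m≤0)  = inj₁ (ℚP.<⇒≤ 0<q , inj₁ (Equivalence.from c≤0⇔m≤0 m≤0))
  from (inj₂ m²≤D) = inj₁ (ℚP.<⇒≤ 0<q , inj₂ (Equivalence.from c²≤q²D⇔m²≤D m²≤D))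

numerator-shift : ∀ {p P Q} n → p ℚ.* ℤ→ℚ Q ≡ ℤ→ℚ P →
  (ℤ→ℚ n ℚ.- p) ℚ.* ℤ→ℚ Q ≡ ℤ→ℚ (n * Q - P)
numerator-shift {p} {P} {Q} n pQ≡P = begin
  (ℤ→ℚ n ℚ.- p) ℚ.* ℤ→ℚ Q            ≡⟨ distrib (ℤ→ℚ n) p (ℤ→ℚ Q) ⟩
  ℤ→ℚ n ℚ.* ℤ→ℚ Q ℚ.- p ℚ.* ℤ→ℚ Q    ≡⟨ cong₂ ℚ._-_ (ℤ→ℚ-homo-* n Q) (sym pQ≡P) ⟨
  ℤ→ℚ (n * Q) ℚ.- ℤ→ℚ P              ≡⟨ ℤ→ℚ-homo-sub (n * Q) P ⟨
  ℤ→ℚ (n * Q - P)                    ∎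
  where
  open ≡-Reasoning
  distrib : ∀ x y z → (x ℚ.- y) ℚ.* z ≡ x ℚ.* z ℚ.- y ℚ.* z
  distrib = RingSolver.solve-∀ ℚ-ring

IsFloor⇒bounds : ∀ {D} x a σ → 0ℤ < Q σ → x ≐ P σ +√D/ Q σ → IsFloor D x a →
  a * Q σ - P σ ≤√ D × ¬ ((a + 1ℤ) * Q σ - P σ ≤√ D)
IsFloor⇒bounds {D} (p , q) a σ 0<Q (pQ≡P , qQ≡1) (a≤x , a+1≰x) =
  Equivalence.to (bound a) a≤x , λ a+1≤√D → a+1≰x (Equivalence.from (bound (a + 1ℤ)) a+1≤√D)
  where
  bound : ∀ n → LeQD D n (p , q) ⇔ n * Q σ - P σ ≤√ D
  bound n = LeSqrt⇔≤√ 0<Q (numerator-shift n pQ≡P) qQ≡1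

next-quotient : ∀ {D} α β a σ → 0ℤ < Q σ → α ≐ P σ +√D/ Q σ →
  mulQD D (subℤQD α a) β ≡ oneQD → Q₋₁ σ * Q σ ≡ + D - P σ * P σ →
  β ≐ P (next a σ) +√D/ Q (next a σ)
next-quotient {D} (p , q) (c , d) a σ 0<Q (pQ≡P , qQ≡1) αβ≡1 invariant =
  reciprocal-step {ℕ→ℚ D} {p} {q} {ℤ→ℚ a} {ℤ→ℚ (Q σ)} {ℤ→ℚ (P σ′)} {ℤ→ℚ (Q σ′)} {c} {d}
    {{ℚP.pos⇒nonZero (ℤ→ℚ (Q σ)) {{ℤ→ℚ-pos 0<Q}}}}
    qQ≡1 P′≡ QQ′≡ (cong proj₁ αβ≡1) (cong proj₂ αβ≡1)
  where
  open ≡-Reasoning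
  σ′ = next a σ
  P′≡ : ℤ→ℚ (P σ′) ≡ ℤ→ℚ a ℚ.* ℤ→ℚ (Q σ) ℚ.- p ℚ.* ℤ→ℚ (Q σ)
  P′≡ = trans (ℤ→ℚ-homo-sub (a * Q σ) (P σ)) (cong₂ ℚ._-_ (ℤ→ℚ-homo-* a (Q σ)) (sym pQ≡P))
  QQ′≡ : ℤ→ℚ (Q σ) ℚ.* ℤ→ℚ (Q σ′) ≡ ℕ→ℚ D ℚ.- ℤ→ℚ (P σ′) ℚ.* ℤ→ℚ (P σ′)
  QQ′≡ = begin
    ℤ→ℚ (Q σ) ℚ.* ℤ→ℚ (Q σ′)              ≡⟨ ℤ→ℚ-homo-* (Q σ) (Q σ′) ⟨
    ℤ→ℚ (Q σ * Q σ′)                      ≡⟨ cong ℤ→ℚ (next-invariant {+ D} a σ invariant) ⟩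
    ℤ→ℚ (+ D - P σ′ * P σ′)               ≡⟨ ℤ→ℚ-homo-sub (+ D) (P σ′ * P σ′) ⟩
    ℕ→ℚ D ℚ.- ℤ→ℚ (P σ′ * P σ′)           ≡⟨ cong (λ x → ℕ→ℚ D ℚ.- x) (ℤ→ℚ-homo-* (P σ′) (P σ′)) ⟩
    ℕ→ℚ D ℚ.- ℤ→ℚ (P σ′) ℚ.* ℤ→ℚ (P σ′)   ∎

denominator-pos : ∀ {D T P′ Q Q′} → T * T < D → 0ℤ < Q → - T ≤ P′ → P′ ≤ T →
  Q * Q′ ≡ D - P′ * P′ → 0ℤ < Q′
denominator-pos {D} {T} {P′} {Q} {Q′} T²<D 0<Q -T≤P′ P′≤T QQ′≡ =
  ℤP.*-cancelˡ-<-nonNeg Q {{ℤ.nonNegative (ℤP.<⇒≤ 0<Q)}} (begin-strict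
    Q * 0ℤ                                ≡⟨ ℤP.*-zeroʳ Q ⟩
    0ℤ                                    <⟨ ℤP.+-mono-<-≤ (i<j⇒0<j-i T²<D)
                                               (*-nonNeg (ℤP.i≤j⇒0≤j-i P′≤T) (ℤP.i≤j⇒0≤j-i -T≤P′)) ⟩
    (D - T * T) + (T - P′) * (P′ - - T)   ≡⟨ solve (D ∷ T ∷ P′ ∷ []) ⟩
    D - P′ * P′                           ≡⟨ QQ′≡ ⟨
    Q * Q′                                ∎)
  where open ℤP.≤-Reasoning

-T≤aQ-P : ∀ {T a P Q} → 0ℤ < a → 0ℤ < Q → P ≤ T → - T ≤ a * Q - P
-T≤aQ-P {T} {a} {P} {Q} 0<a 0<Q P≤T = begin
  - T            ≤⟨ ℤP.neg-mono-≤ P≤T ⟩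
  - P            ≡⟨ ℤP.+-identityˡ (- P) ⟨
  0ℤ - P         ≤⟨ ℤP.+-monoˡ-≤ (- P) (*-nonNeg (ℤP.<⇒≤ 0<a) (ℤP.<⇒≤ 0<Q)) ⟩
  a * Q - P      ∎
  where open ℤP.≤-Reasoning

Q≡1-at-2T : ∀ {T P Q} → 0ℤ < T → 0ℤ < Q → P ≤ T → + 2 * T * Q - P ≤ T → Q ≡ 1ℤ × P ≡ T
Q≡1-at-2T {T} {P} {Q} 0<T 0<Q P≤T P′≤T = Q≡1 , ℤP.≤-antisym P≤T T≤P
  where
  open ℤP.≤-Reasoning
  Q≤1 : Q ≤ 1ℤ
  Q≤1 = ℤP.*-cancelˡ-≤-pos Q 1ℤ (+ 2 * T) {{ℤ.positive (ℤP.*-monoˡ-<-pos (+ 2) 0<T)}} (begin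
    + 2 * T * Q               ≡⟨ solve (T ∷ Q ∷ P ∷ []) ⟩
    (+ 2 * T * Q - P) + P     ≤⟨ ℤP.+-mono-≤ P′≤T P≤T ⟩
    T + T                     ≡⟨ solve (T ∷ []) ⟩
    + 2 * T * 1ℤ              ∎)
  Q≡1 : Q ≡ 1ℤ
  Q≡1 = ℤP.≤-antisym Q≤1 (ℤP.i<j⇒suc[i]≤j 0<Q)
  T≤P : T ≤ P
  T≤P = ℤP.0≤i-j⇒j≤i (begin
    0ℤ                        ≤⟨ ℤP.i≤j⇒0≤j-i (subst (λ q → + 2 * T * q - P ≤ T) Q≡1 P′≤T) ⟩
    T - (+ 2 * T * 1ℤ - P)    ≡⟨ solve (T ∷ P ∷ []) ⟩
    P - T                     ∎)

-- Positivity of all partial quotients is assumed; it holds for every expansion of √D with D > 1.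
module Expansion {D : ℕ} {a : ℕ → ℤ} (a-pos : ∀ k → 0ℤ < a k) (nonSquare : ¬ IsSquare D)
  (α : ℕ → QD) (α₀ : α 0 ≡ sqrtQD) (floor : ∀ k → IsFloor D (α k) (a k))
  (recip : ∀ k → mulQD D (subℤQD (α k) (a k)) (α (suc k)) ≡ oneQD) where

  T : ℤ
  T = a 0

  C : ℤ
  C = + D - T * T

  D≡T²+C : + D ≡ T * T + C
  D≡T²+C = sym (cancel T (+ D))
    where
    cancel : ∀ x y → x * x + (y - x * x) ≡ y
    cancel = solve-∀

  s : ℕ → State
  s = states D a

  bounds : ∀ k → 0ℤ < Q (s k) → α k ≐ P (s k) +√D/ Q (s k) →
    a k * Q (s k) - P (s k) ≤√ D × ¬ ((a k + 1ℤ) * Q (s k) - P (s k) ≤√ D)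
  bounds k 0<Q α≐ = IsFloor⇒bounds (α k) (a k) (s k) 0<Q α≐ (floor k)

  α₀≐ : α 0 ≐ P (s 0) +√D/ Q (s 0)
  α₀≐ rewrite α₀ = refl , refl

  T-floor : T ≤√ D × ¬ (T + 1ℤ ≤√ D)
  T-floor = subst (_≤√ D) (n*1-0≡n T) T≤√D , λ T+1≤√D → T+1≰√D (subst (_≤√ D) (sym (n*1-0≡n (T + 1ℤ))) T+1≤√D)
    where
    n*1-0≡n : ∀ n → n * 1ℤ - 0ℤ ≡ n
    n*1-0≡n = solve-∀
    T≤√D = proj₁ (bounds 0 0<1 α₀≐)
    T+1≰√D = proj₂ (bounds 0 0<1 α₀≐)

  T²<D : T * T < + D
  T²<D = ℤP.≤∧≢⇒< (≤√⇒² (a-pos 0) (proj₁ T-floor)) λ T²≡D →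
    nonSquare (ℤ.∣ T ∣ , trans (sym (ℤP.abs-* T T)) (cong ℤ.∣_∣ T²≡D))

  D<[T+1]² : + D < (T + 1ℤ) * (T + 1ℤ)
  D<[T+1]² = ℤP.≰⇒> λ [T+1]²≤D → proj₂ T-floor (inj₂ [T+1]²≤D)

  quotients : ∀ k → α k ≐ P (s k) +√D/ Q (s k) × 0ℤ < Q (s k) × P (s k) ≤ T
  quotients zero = α₀≐ , 0<1 , ℤP.<⇒≤ (a-pos 0)
  quotients (suc k) with quotients k
  ... | α≐ , 0<Q , P≤T = next-quotient (α k) (α (suc k)) (a k) (s k) 0<Q α≐ (recip k) (states-invariant D a k)
                       , 0<Q′ , P′≤T
    where
    P′≤T : P (s (suc k)) ≤ T
    P′≤T = ≤√⇒≤ (ℤP.<⇒≤ (a-pos 0)) D<[T+1]² (proj₁ (bounds k 0<Q α≐))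
    0<Q′ : 0ℤ < Q (s (suc k))
    0<Q′ = denominator-pos T²<D 0<Q (-T≤aQ-P (a-pos k) 0<Q P≤T) P′≤T (states-invariant D a (suc k))

  0<Q : ∀ k → 0ℤ < Q (s k)
  0<Q k = proj₁ (proj₂ (quotients k))

  P≤T : ∀ k → P (s k) ≤ T
  P≤T k = proj₂ (proj₂ (quotients k))

  double-T : ∀ k → a k ≡ + 2 * T → Q (s k) ≡ 1ℤ × P (s k) ≡ T
  double-T k aₖ≡2T =
    Q≡1-at-2T (a-pos 0) (0<Q k) (P≤T k) (subst (λ x → x * Q (s k) - P (s k) ≤ T) aₖ≡2T (P≤T (suc k)))

  before-double-T : ∀ k → a (suc k) ≡ + 2 * T → Q (s k) ≡ C
  before-double-T k aₖ₊₁≡2T = begin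
    Q (s k)                                   ≡⟨ ℤP.*-identityʳ (Q (s k)) ⟨
    Q (s k) * 1ℤ                              ≡⟨ cong (Q (s k) *_) (proj₁ (double-T (suc k) aₖ₊₁≡2T)) ⟨
    Q (s k) * Q (s (suc k))                   ≡⟨ states-invariant D a (suc k) ⟩
    + D - P (s (suc k)) * P (s (suc k))       ≡⟨ cong (λ x → + D - x * x) (proj₂ (double-T (suc k) aₖ₊₁≡2T)) ⟩
    + D - T * T                               ∎
    where open ≡-Reasoning

-- P₃ computed by the recurrence from (P₁, Q₁) = (T, C) must equal UC − T, since P₄ = UQ₃ − P₃.
period-equation : ∀ {T U V C} {σ : State} → σ ≡ ⟨ T , C , 1ℤ ⟩ →
  Q₋₁ (next U (next V (next U σ))) ≡ C → P (next U (next V (next U σ))) ≡ T →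
  C * (U * (U * V + + 2)) ≡ + 2 * V * U * T + + 2 * T + V
period-equation {T} {U} {V} {C} refl Q₃≡C P₄≡T = ≡-mod 1ℤ UC-P₃≡T (solve (T ∷ U ∷ V ∷ C ∷ []))
  where
  UC-P₃≡T : U * C - (V * (1ℤ + U * (T - (U * C - T))) - (U * C - T)) ≡ T
  UC-P₃≡T = trans (cong (λ q → U * q - P (next V (next U ⟨ T , C , 1ℤ ⟩))) (sym Q₃≡C)) P₄≡T

period-witness : ∀ T U V C → C * (U * (U * V + + 2)) ≡ + 2 * V * U * T + + 2 * T + V →
  let y = C * (U * V + 1ℤ) - + 2 * T * V in
  (U * V + 1ℤ) * y ≡ C + V * V × U * (y * (U * V + + 2) - V * V) - V ≡ T * + 2 × y * (U * V + + 2) - V * V - y ≡ C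
period-witness T U V C period =
    ≡-mod V period (solve (T ∷ U ∷ V ∷ C ∷ []))
  , ≡-mod (U * V + 1ℤ) period (solve (T ∷ U ∷ V ∷ C ∷ []))
  , ≡-mod V period (solve (T ∷ U ∷ V ∷ C ∷ []))

pattern4-pos : ∀ {t u v} → 0 ℕ.< t → 0 ℕ.< u → 0 ℕ.< v → ∀ k → 0ℤ < pattern4 t u v k
pattern4-pos 0<t _ _ zero = ℤ.+<+ 0<t
pattern4-pos {t} {u} {v} 0<t 0<u 0<v (suc k) = ℤ.+<+ (block-pos k)
  where
  block-pos : ∀ k → 0 ℕ.< periodBlock t u v k
  block-pos 0 = 0<u
  block-pos 1 = 0<v
  block-pos 2 = 0<u
  block-pos 3 = ℕP.<-≤-trans 0<t (ℕP.m≤m+n t (t ℕ.+ 0))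
  block-pos (suc (suc (suc (suc k)))) = block-pos k

uv+2-cast : ∀ u v → + (u ℕ.* v ℕ.+ 2) ≡ + u * + v + + 2
uv+2-cast u v = trans (ℤP.pos-+ (u ℕ.* v) 2) (cong (_+ + 2) (ℤP.pos-* u v))

D≡t²+fraction : ∀ {D C} t u v → 0 ℕ.< u → + D ≡ + t * + t + C →
  C * (+ u * (+ u * + v + + 2)) ≡ + 2 * + v * + u * + t + + 2 * + t + + v →
  ℕ→ℚ D ≡ ℕ→ℚ (t ℕ.* t) ℚ.+ fracℤ (+ (2 ℕ.* v ℕ.* u ℕ.* t ℕ.+ 2 ℕ.* t ℕ.+ v)) (u ℕ.* (u ℕ.* v ℕ.+ 2))
D≡t²+fraction {D} {C} t u v 0<u D≡t²+C period = begin
  ℕ→ℚ D                                 ≡⟨ cong ℤ→ℚ D≡t²+C ⟩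
  ℤ→ℚ (+ t * + t + C)                   ≡⟨ ℤ→ℚ-homo-+ (+ t * + t) C ⟩
  ℤ→ℚ (+ t * + t) ℚ.+ ℤ→ℚ C             ≡⟨ cong₂ ℚ._+_ (cong ℤ→ℚ (ℤP.pos-* t t)) frac≡C ⟨
  ℕ→ℚ (t ℕ.* t) ℚ.+ fracℤ (+ N) M       ∎
  where
  open ≡-Reasoning
  N = 2 ℕ.* v ℕ.* u ℕ.* t ℕ.+ 2 ℕ.* t ℕ.+ v
  M = u ℕ.* (u ℕ.* v ℕ.+ 2)
  0<M : 0 ℕ.< M
  0<M = ℕP.*-mono-< 0<u (ℕP.<-≤-trans (ℕ.s≤s ℕ.z≤n) (ℕP.m≤n+m 2 (u ℕ.* v)))
  M-cast : + M ≡ + u * (+ u * + v + + 2)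
  M-cast = trans (ℤP.pos-* u _) (cong (+ u *_) (uv+2-cast u v))
  N-cast : + N ≡ + 2 * + v * + u * + t + + 2 * + t + + v
  N-cast = begin
    + N                                                ≡⟨ ℤP.pos-+ (2 ℕ.* v ℕ.* u ℕ.* t ℕ.+ 2 ℕ.* t) v ⟩
    + (2 ℕ.* v ℕ.* u ℕ.* t ℕ.+ 2 ℕ.* t) + + v          ≡⟨ cong (_+ + v) (ℤP.pos-+ (2 ℕ.* v ℕ.* u ℕ.* t) (2 ℕ.* t)) ⟩
    + (2 ℕ.* v ℕ.* u ℕ.* t) + + (2 ℕ.* t) + + v        ≡⟨ cong₂ (λ x y → x + y + + v) vut-cast (ℤP.pos-* 2 t) ⟩
    + 2 * + v * + u * + t + + 2 * + t + + v            ∎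
    where
    vut-cast : + (2 ℕ.* v ℕ.* u ℕ.* t) ≡ + 2 * + v * + u * + t
    vut-cast = trans (ℤP.pos-* (2 ℕ.* v ℕ.* u) t)
                 (cong (_* + t) (trans (ℤP.pos-* (2 ℕ.* v) u) (cong (_* + u) (ℤP.pos-* 2 v))))
  frac≡C : fracℤ (+ N) M ≡ ℤ→ℚ C
  frac≡C = trans (cong (λ p → fracℤ p M) (trans N-cast (trans (sym period) (cong (C *_) (sym M-cast)))))
                 (fracℤ-* C 0<M)

D≡square+witness : ∀ {D C} t u v → 0ℤ ≤ C → + D ≡ + t * + t + C →
  C * (+ u * (+ u * + v + + 2)) ≡ + 2 * + v * + u * + t + + 2 * + t + + v →
  ∃ λ (y : ℕ) →
    ℕ→ℚ D ≡ fracℤ ((+ u) * ((+ y) * (+ (u ℕ.* v ℕ.+ 2)) - (+ (v ℕ.* v))) - (+ v)) 2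
              ℚ.* fracℤ ((+ u) * ((+ y) * (+ (u ℕ.* v ℕ.+ 2)) - (+ (v ℕ.* v))) - (+ v)) 2
            ℚ.+ ℤ→ℚ ((+ y) * (+ (u ℕ.* v ℕ.+ 2)) - (+ (v ℕ.* v)) - (+ y))
D≡square+witness {D} {C} t u v 0≤C D≡t²+C period = y , (begin
  ℕ→ℚ D                                       ≡⟨ cong ℤ→ℚ D≡t²+C ⟩
  ℤ→ℚ (+ t * + t + C)                         ≡⟨ ℤ→ℚ-homo-+ (+ t * + t) C ⟩
  ℤ→ℚ (+ t * + t) ℚ.+ ℤ→ℚ C                   ≡⟨ cong (ℚ._+ ℤ→ℚ C) (ℤ→ℚ-homo-* (+ t) (+ t)) ⟩
  ℤ→ℚ (+ t) ℚ.* ℤ→ℚ (+ t) ℚ.+ ℤ→ℚ C           ≡⟨ cong₂ (λ x z → x ℚ.* x ℚ.+ ℤ→ℚ z) X/2≡t Z≡C ⟨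
  fracℤ X 2 ℚ.* fracℤ X 2 ℚ.+ ℤ→ℚ Z           ∎)
  where
  open ≡-Reasoning
  yℤ = C * (+ u * + v + 1ℤ) - + 2 * + t * + v
  y = ℤ.∣ yℤ ∣
  W = + y * + (u ℕ.* v ℕ.+ 2) - + (v ℕ.* v)
  X = + u * W - + v
  Z = W - + y
  witness = period-witness (+ t) (+ u) (+ v) C period
  uv+1·y≡C+v² = proj₁ witness
  0≤y : 0ℤ ≤ yℤ
  0≤y = nonNeg-factor 0<uv+1 (subst (0ℤ ≤_) (sym uv+1·y≡C+v²) (ℤP.+-mono-≤ 0≤C (*-nonNeg (0≤+ v) (0≤+ v))))
    where
    0<uv+1 : 0ℤ < + u * + v + 1ℤ
    0<uv+1 = ℤP.+-mono-≤-< (*-nonNeg (0≤+ u) (0≤+ v)) 0<1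
  W≡ : W ≡ yℤ * (+ u * + v + + 2) - + v * + v
  W≡ = cong₂ (λ w n → w - n)
         (cong₂ _*_ (ℤP.0≤i⇒+∣i∣≡i 0≤y) (uv+2-cast u v)) (ℤP.pos-* v v)
  X/2≡t : fracℤ X 2 ≡ ℤ→ℚ (+ t)
  X/2≡t = trans (cong (λ p → fracℤ p 2) (trans (cong (λ w → + u * w - + v) W≡) (proj₁ (proj₂ witness))))
                (fracℤ-* (+ t) (ℕ.s≤s ℕ.z≤n))
  Z≡C : Z ≡ C
  Z≡C = trans (cong₂ _-_ W≡ (ℤP.0≤i⇒+∣i∣≡i 0≤y)) (proj₂ (proj₂ witness))

proposition2p2 : (D t u v : ℕ) → 0 ℕ.< D → 0 ℕ.< t → 0 ℕ.< u → 0 ℕ.< v →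
    CFExpansionSqrt D (pattern4 t u v) →
    (ℕ→ℚ D ≡ ℕ→ℚ (t ℕ.* t) ℚ.+ fracℤ (+ (2 ℕ.* v ℕ.* u ℕ.* t ℕ.+ 2 ℕ.* t ℕ.+ v)) (u ℕ.* (u ℕ.* v ℕ.+ 2)))
    × ∃ λ (y : ℕ) →
      ℕ→ℚ D ≡ fracℤ ((+ u) ℤ.* ((+ y) ℤ.* (+ (u ℕ.* v ℕ.+ 2)) ℤ.- (+ (v ℕ.* v))) ℤ.- (+ v)) 2
                ℚ.* fracℤ ((+ u) ℤ.* ((+ y) ℤ.* (+ (u ℕ.* v ℕ.+ 2)) ℤ.- (+ (v ℕ.* v))) ℤ.- (+ v)) 2
              ℚ.+ ℤ→ℚ ((+ y) ℤ.* (+ (u ℕ.* v ℕ.+ 2)) ℤ.- (+ (v ℕ.* v)) ℤ.- (+ y))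
proposition2p2 D t u v _ 0<t 0<u 0<v (nonSquare , α , α₀ , floor , recip) =
  D≡t²+fraction t u v 0<u D≡T²+C period , D≡square+witness t u v (ℤP.<⇒≤ (i<j⇒0<j-i T²<D)) D≡T²+C period
  where
  open Expansion (pattern4-pos 0<t 0<u 0<v) nonSquare α α₀ floor recip
  2t≡2T : + (2 ℕ.* t) ≡ + 2 * T
  2t≡2T = ℤP.pos-* 2 t
  period : C * (+ u * (+ u * + v + + 2)) ≡ + 2 * + v * + u * T + + 2 * T + + v
  period = period-equation {U = + u} {V = + v} (states-one D (pattern4 t u v)) (before-double-T 3 2t≡2T) (proj₂ (double-T 4 2t≡2T))
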